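{- Let $\Gamma=(D,A,B)$ be a web (satisfying the standing assumptions below), let $Q\subseteq V\setminus(A\cup B)$, and let $\mathcal U$ be a wave in $\Gamma-Q$ such that $N^+(Q)\setminus Q\subseteq RF_{\Gamma-Q}(ter[\mathcal U])$. Then $\mathcal U$ is a wave in $\Gamma$.
   Context: A web is $\Gamma=(D,A,B)$, $D$ a digraph, $V=V(D)$, $A,B\subseteq V$. Standing assumptions: no edge has head in $A$ or tail in $B$; every vertex of $A$ can reach $B$. Paths are simple directed paths with initial vertex $in(P)$, finite (terminal vertex $ter(P)$) or one-way infinite; single vertices are paths. A warp is a set of pairwise vertex-disjoint paths; $in[\mathcal W]$ and $ter[\mathcal W]$ are the initial vertices of its paths and terminal vertices of its finite paths. A wave in a web $(D',A',B')$ is a warp in $D'$ with all initial vertices in $A'$ whose terminal set meets every finite path from $A'$ to $B'$. $\Gamma-Q=(D-Q,A\setminus Q,B\setminus Q)$. $N^+(Q)$ is the set of out-neighbours of vertices of $Q$. For a web $\Delta$ with target set $B_\Delta$ and a set $S$, $RF_\Delta(S)$ is the set of vertices $v$ of $\Delta$ such that every path in $\Delta$ from $v$ to a vertex of $B_\Delta$ meets $S$. -}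

module Defs where

open import Level using (0ℓ)
open import Data.Nat using (ℕ; suc)
open import Data.Fin using (Fin; zero; suc; inject₁; fromℕ)
open import Data.Sum using (_⊎_; inj₁; inj₂)
open import Data.Product using (Σ; ∃; _×_; _,_)
open import Data.Unit using (⊤)
open import Relation.Nullary using (¬_)
open import Relation.Binary.PropositionalEquality using (_≡_)
open import Function.Definitions using (Injective)

-- A digraph "inside" (V,E)
-- is given by a vertex predicate Vx; its edges are the E-edges between
-- vertices of Vx (this is exactly how D - Q arises from D).

module _ {V : Set} (E : V → V → Set) where

  record FinPath : Set where
    field
      len  : ℕ
      vx   : Fin (suc len) → V
      inj  : Injective _≡_ _≡_ vx
      step : (i : Fin len) → E (vx (inject₁ i)) (vx (suc i))

  record InfPath : Set where
    field
      vx   : ℕ → V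
      inj  : Injective _≡_ _≡_ vx
      step : (i : ℕ) → E (vx i) (vx (suc i))

  Path : Set
  Path = FinPath ⊎ InfPath

  onFin : FinPath → V → Set
  onFin P v = ∃ λ i → FinPath.vx P i ≡ v

  onPath : Path → V → Set
  onPath (inj₁ P) v = onFin P v
  onPath (inj₂ P) v = ∃ λ i → InfPath.vx P i ≡ v

  inF : FinPath → V
  inF P = FinPath.vx P zero

  terF : FinPath → V
  terF P = FinPath.vx P (fromℕ (FinPath.len P))

  init : Path → V
  init (inj₁ P) = inF P
  init (inj₂ P) = InfPath.vx P 0

  PathIn : (V → Set) → Path → Set
  PathIn Vx P = ∀ v → onPath P v → Vx v

  FinPathIn : (V → Set) → FinPath → Set
  FinPathIn Vx P = ∀ v → onFin P v → Vx v

  Meets : FinPath → (V → Set) → Set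
  Meets P S = ∃ λ v → onFin P v × S v

  record Warp : Set₁ where
    field
      I        : Set
      path     : I → Path
      disjoint : ∀ i j v → onPath (path i) v → onPath (path j) v → i ≡ j

  inSet : Warp → V → Set
  inSet W v = ∃ λ i → init (Warp.path W i) ≡ v

  terSet : Warp → V → Set
  terSet W v = ∃ λ i → ∃ λ P → (Warp.path W i ≡ inj₁ P) × (terF P ≡ v)

  IsWarpIn : (V → Set) → Warp → Set
  IsWarpIn Vx W = ∀ i → PathIn Vx (Warp.path W i)

  IsWave : (Vx A' B' : V → Set) → Warp → Set
  IsWave Vx A' B' W =
      IsWarpIn Vx W
    × (∀ i → A' (init (Warp.path W i)))
    × (∀ (P : FinPath) → FinPathIn Vx P → A' (inF P) → B' (terF P)
         → Meets P (terSet W))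

  RF : (Vx B' S : V → Set) → V → Set
  RF Vx B' S v = Vx v × (∀ (P : FinPath) → FinPathIn Vx P → inF P ≡ v
                          → B' (terF P) → Meets P S)

  OutNbr : (V → Set) → V → Set
  OutNbr Q v = ∃ λ q → Q q × E q v

_⊆_ : {V : Set} → (V → Set) → (V → Set) → Set
X ⊆ Y = ∀ v → X v → Y v

record Web : Set₁ where
  field
    V : Set
    E : V → V → Set
    A : V → Set
    B : V → Set
    noHeadInA : ∀ u v → E u v → ¬ A v
    noTailInB : ∀ u v → E u v → ¬ B u
    reachB    : ∀ a → A a → ∃ λ (P : FinPath E) → (inF E P ≡ a) × B (terF E P)

All : {V : Set} → V → Set
All _ = ⊤

-- Γ - Q : vertex set V \ Q, sources A \ Q, targets B \ Q
minus : {V : Set} → (V → Set) → (V → Set) → V → Set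
minus X Q v = X v × ¬ Q v

module Submission where

-- An A–B path of D avoiding Q is an (A∖Q)–(B∖Q) path of Γ − Q, so it meets ter[U].
-- Otherwise its segment after the last vertex in Q is nonempty (the terminal vertex
-- lies in B, hence not in Q), avoids Q and starts in N⁺(Q) ∖ Q, so by the RF
-- hypothesis it meets ter[U].  Excluded middle decides whether a path meets Q.

open import Defs
open import Level using (0ℓ)
open import Axiom.ExcludedMiddle using (ExcludedMiddle)
open import Data.Product using (_×_; _,_; proj₁; proj₂)
open import Data.Nat using (zero; suc)
open import Data.Fin using (zero; suc; fromℕ)
open import Data.Fin.Properties using (suc-injective)
open import Data.Empty using (⊥-elim)
open import Data.Unit using (tt)
open import Relation.Nullary using (¬_; Dec; yes; no)
open import Relation.Binary.PropositionalEquality using (_≡_; refl; sym; subst)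

module _ {V : Set} {E : V → V → Set} where

  inF∈ : (P : FinPath E) → onFin E P (inF E P)
  inF∈ P = zero , refl

  terF∈ : (P : FinPath E) → onFin E P (terF E P)
  terF∈ P = fromℕ (FinPath.len P) , refl

  Meets-mono : ∀ {P P′ S} → (∀ v → onFin E P v → onFin E P′ v) → Meets E P S → Meets E P′ S
  Meets-mono P⊆P′ (v , v∈P , v∈S) = v , P⊆P′ v v∈P , v∈S

  Avoids : FinPath E → (V → Set) → Set
  Avoids P Q = FinPathIn E (λ v → ¬ Q v) P

  ¬Meets⇒Avoids : ∀ P {Q} → ¬ Meets E P Q → Avoids P Q
  ¬Meets⇒Avoids _ ¬meets v v∈P v∈Q = ¬meets (v , v∈P , v∈Q)

  record LastExit (Q : V → Set) (P : FinPath E) : Set where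
    field
      segment  : FinPath E
      entered  : OutNbr E Q (inF E segment)
      avoids   : Avoids segment Q
      same-ter : terF E segment ≡ terF E P
      ⊆path    : ∀ v → onFin E segment v → onFin E P v

  lastExit : ExcludedMiddle 0ℓ → ∀ {Q} (P : FinPath E) →
             ¬ Q (terF E P) → Meets E P Q → LastExit Q P
  lastExit em {Q} P = byLength (FinPath.len P) P refl
    where
      byLength : ∀ n (P : FinPath E) → FinPath.len P ≡ n →
                 ¬ Q (terF E P) → Meets E P Q → LastExit Q P
      byLength zero record { len = zero } refl ¬Qter (_ , (zero , refl) , q) = ⊥-elim (¬Qter q)
      byLength (suc n) P@record { vx = vx ; inj = inj ; step = step } refl ¬Qter meets =
        exitFrom (em {Meets E tail Q})
        where
          tail : FinPath E
          tail = record { len = n ; vx = λ i → vx (suc i)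
                        ; inj = λ e → suc-injective (inj e) ; step = λ i → step (suc i) }

          exitFrom : Dec (Meets E tail Q) → LastExit Q P
          exitFrom (yes meetsTail) = record
            { segment = segment ; entered = entered ; avoids = avoids ; same-ter = same-ter
            ; ⊆path = λ v v∈seg → shift (⊆path v v∈seg) }
            where
              open LastExit (byLength n tail refl ¬Qter meetsTail)
              shift : ∀ {v} → onFin E tail v → onFin E P v
              shift (i , eq) = suc i , eq
          exitFrom (no ¬meetsTail) = record
            { segment = tail ; entered = vx zero , Q-head meets , step zero
            ; avoids = ¬Meets⇒Avoids tail ¬meetsTail ; same-ter = refl
            ; ⊆path = λ { v (i , eq) → suc i , eq } }
            where
              Q-head : Meets E P Q → Q (vx zero)
              Q-head (v , (zero , eq) , q) = subst Q (sym eq) q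
              Q-head (v , (suc i , eq) , q) = ⊥-elim (¬meetsTail (v , (i , eq) , q))

  LastExit-meets-RF : ∀ {Q B S P} →
    minus (OutNbr E Q) Q ⊆ RF E (λ v → ¬ Q v) (minus B Q) S →
    B (terF E P) → LastExit Q P → Meets E P S
  LastExit-meets-RF {Q} {B} {P = P} exits⊆RF Bter e =
    Meets-mono {P = segment} {P′ = P} ⊆path
      (proj₂ (exits⊆RF _ (entered , avoids _ (inF∈ segment))) segment avoids refl (subst B (sym same-ter) Bter , avoids _ (terF∈ segment)))
    where open LastExit e

lemma6p2 : ExcludedMiddle 0ℓ → (Γ : Web) → let open Web Γ in
    (Q : V → Set) → (∀ v → Q v → ¬ A v × ¬ B v) →
    (U : Warp E) →
    IsWave E (λ v → ¬ Q v) (minus A Q) (minus B Q) U →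
    (minus (OutNbr E Q) Q ⊆ RF E (λ v → ¬ Q v) (minus B Q) (terSet E U)) →
    IsWave E All A B U
lemma6p2 em Γ Q Q∌AB U (_ , U-from-A , U-separates) exits⊆RF =
  (λ _ _ _ → tt) , (λ i → proj₁ (U-from-A i)) , separates
  where
    open Web Γ
    separates : ∀ P → FinPathIn E All P → A (inF E P) → B (terF E P) → Meets E P (terSet E U)
    separates P _ Ain Bter with em {Meets E P Q}
    ... | yes meets =
      LastExit-meets-RF {B = B} exits⊆RF Bter (lastExit em P (λ q → proj₂ (Q∌AB _ q) Bter) meets)
    ... | no ¬meets = U-separates P avoids (Ain , avoids _ (inF∈ P)) (Bter , avoids _ (terF∈ P))
      where
        avoids : Avoids P Q
        avoids = ¬Meets⇒Avoids P ¬meets
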